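{- There is an absolute constant $C$ with the following property. Let $G$ be a connected $3$-colorable graph of order $n$, diameter $D$ and minimum degree at least $\delta\ge 1$. Suppose $G$ has a proper $3$-coloring and a vertex $x$ of eccentricity $D$ such that, with $L_j$ the set of vertices at distance $j$ from $x$ and $c(j)$ the number of colors used on $L_j$, for every $0\le i\le D-1$: (i) if $c(i)=1$ then $c(i+1)\le 2$; (ii) $L_i\cup L_{i+1}$ uses $\min(3,c(i)+c(i+1))$ colors; (iii) if $c(i)=3$ then $i\ge 2$ and $c(i+1)\ge 2$; (iv) if $|L_i|>c(i)$ then $i>0$ and $c(i)+\max(c(i-1),c(i+1))\ge 3$; and moreover $c(i)\ge 2$ for every $0<i<D$. Then \[ \operatorname{diam}(G)\le \frac{7n}{3\delta}+C. \]
   Context: Conditions (i)–(iv) are what the paper calls the clump graph of $G$ being canonical; the hypothesis $c(i)\ge 2$ for $0<i<D$ says no layer other than $L_0$ and $L_D$ is single-colored. The paper writes the additive term as $O(1)$. -}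

module Defs where

open import Data.Nat using (ℕ; zero; suc; _+_; _*_; _∸_; _≤_; _<_; _⊓_; _⊔_)
open import Data.Fin using (Fin; _≟_)
open import Data.Bool using (Bool; true; false; _∧_; _∨_; not; if_then_else_)
open import Data.List using (List; map; allFin)
open import Data.Nat.ListAction using (sum)
open import Data.Bool.ListAction using (any)
open import Data.Product using (_×_; ∃; Σ)
open import Relation.Nullary using (¬_)
open import Relation.Nullary.Decidable using (⌊_⌋)
open import Relation.Binary.PropositionalEquality using (_≡_; _≢_)

record Graph (n : ℕ) : Set where
  field
    Adj    : Fin n → Fin n → Bool
    sym    : ∀ u v → Adj u v ≡ Adj v u
    irrefl : ∀ v → Adj v v ≡ false
open Graph public

countF : (m : ℕ) → (Fin m → Bool) → ℕ
countF m p = sum (map (λ i → if p i then 1 else 0) (allFin m))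

anyF : (m : ℕ) → (Fin m → Bool) → Bool
anyF m p = any p (allFin m)

degree : ∀ {n} → Graph n → Fin n → ℕ
degree {n} G v = countF n (Adj G v)

-- within G x k v = true  iff  dist(x,v) ≤ k
within : ∀ {n} → Graph n → Fin n → ℕ → Fin n → Bool
within G x zero v = ⌊ x ≟ v ⌋
within {n} G x (suc k) v = within G x k v ∨ anyF n (λ u → within G x k u ∧ Adj G u v)

-- layer G x j v = true  iff  dist(x,v) = j   (v ∈ L_j)
layer : ∀ {n} → Graph n → Fin n → ℕ → Fin n → Bool
layer G x zero v = within G x zero v
layer G x (suc j) v = within G x (suc j) v ∧ not (within G x j v)

Connected : ∀ {n} → Graph n → Set
Connected G = ∀ u v → ∃ λ k → within G u k v ≡ true

Eccentricity : ∀ {n} → Graph n → Fin n → ℕ → Set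
Eccentricity G x D = (∀ v → within G x D v ≡ true) × ∃ λ v → layer G x D v ≡ true

Diameter : ∀ {n} → Graph n → ℕ → Set
Diameter G D = (∀ u v → within G u D v ≡ true) × ∃ λ u → ∃ λ v → layer G u D v ≡ true

MinDegreeAtLeast : ∀ {n} → Graph n → ℕ → Set
MinDegreeAtLeast G δ = ∀ v → δ ≤ degree G v

ProperColoring : ∀ {n} → Graph n → (Fin n → Fin 3) → Set
ProperColoring G col = ∀ u v → Adj G u v ≡ true → col u ≢ col v

numColors : ∀ {n} → (Fin n → Fin 3) → (Fin n → Bool) → ℕ
numColors {n} col S = countF 3 (λ k → anyF n (λ v → S v ∧ ⌊ col v ≟ k ⌋))

c : ∀ {n} → Graph n → (Fin n → Fin 3) → Fin n → ℕ → ℕ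
c G col x j = numColors col (layer G x j)

layerSize : ∀ {n} → Graph n → Fin n → ℕ → ℕ
layerSize {n} G x j = countF n (layer G x j)

-- conditions (i)-(iv): the clump graph is canonical
Canonical : ∀ {n} → Graph n → (Fin n → Fin 3) → Fin n → ℕ → Set
Canonical G col x D = ∀ i → i < D →
    (c' i ≡ 1 → c' (suc i) ≤ 2)
  × (numColors col (λ v → layer G x i v ∨ layer G x (suc i) v) ≡ 3 ⊓ (c' i + c' (suc i)))
  × (c' i ≡ 3 → 2 ≤ i × 2 ≤ c' (suc i))
  × (c' i < layerSize G x i → 0 < i × 3 ≤ c' i + (c' (i ∸ 1) ⊔ c' (suc i)))
  where
  c' = c G col x

-- A vertex of L_{j+1} has all its neighbours in the band
-- L_j ∪ L_{j+1} ∪ L_{j+2}, avoiding its own colour, so a colour a present on L_{j+1} gives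
-- δ ≤ #(band minus colour a). When two interior layers have c ≥ 2 and together use all three
-- colours, one can pick two colours on L_{j+1} and the third on its neighbour layer. Moving the
-- third bound to the band of L_{j+1} costs the size of one outside layer, after which the three
-- bounds count every band vertex exactly twice: 3δ ≤ 2(ℓ_j + ℓ_{j+1} + ℓ_{j+2}) + ℓ_{j+3} (or ℓ_{j-1}).
-- Doing this forwards and backwards inside a run of seven layers gives 3δ ≤ ℓ_s + … + ℓ_{s+6},
-- and the ⌊D/7⌋ disjoint runs give 3δ⌊D/7⌋ ≤ n, i.e. 3δD ≤ 7n + 18δ.
-- Only condition (ii), the bound c(i) ≥ 2, properness and the minimum degree are needed.
module Submission where

open import Defs
open import Data.Nat using (ℕ; zero; suc; _+_; _*_; _≤_; _<_; z≤n; s≤s)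
open import Data.Nat.Properties
  using (+-mono-≤; +-monoˡ-≤; *-monoʳ-≤; *-cancelˡ-≤; +-assoc; +-comm; +-suc; +-identityʳ;
         ≤-refl; ≤-trans; ≤-reflexive; ≤-pred; n≤1+n; 1+n≰n; suc-injective; m≤m+n; m≤n+m;
         m≤n⇒m⊓n≡m; +-commutativeSemigroup; module ≤-Reasoning)
open import Algebra.Properties.CommutativeSemigroup +-commutativeSemigroup using (interchange)
open import Data.Nat.DivMod using (_/_; m≡m%n+[m/n]*n; m%n<n; m/n*n≤m)
open import Data.Nat.ListAction using (sum)
open import Data.Nat.Tactic.RingSolver using (solve-∀)
open import Data.Fin using (Fin; zero; suc; _≟_)
open import Data.Fin.Properties using (all?; ¬∀⟶∃¬)
open import Data.Bool using (Bool; true; false; _∧_; _∨_; not; if_then_else_) renaming (_≟_ to _≟ᵇ_)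
open import Data.Bool.Properties using (T-≡; ¬-not; ∨-comm; ∨-identityʳ; ∧-conicalˡ; ∧-conicalʳ)
open import Data.List using (List; []; _∷_; map; allFin; length)
open import Data.List.Properties using (length-tabulate; map-cong)
open import Data.List.Relation.Unary.All as All using (All; _∷_)
open import Data.List.Relation.Unary.Any using (Any; here; there; satisfied)
open import Data.List.Relation.Unary.Any.Properties using (any⁺; any⁻)
open import Data.List.Membership.Propositional using (lose)
open import Data.List.Membership.Propositional.Properties using (∈-allFin)
open import Data.Product using (∃; _×_; _,_; proj₁; proj₂)
open import Data.Sum using (_⊎_; inj₁; inj₂)
open import Data.Empty using (⊥-elim)
open import Function using (_∘_; id)
open import Function.Bundles using (Equivalence)
open import Relation.Nullary using (yes; no)
open import Relation.Nullary.Decidable using (⌊_⌋; toWitness; fromWitnessFalse)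
open import Relation.Binary.PropositionalEquality using (_≡_; _≢_; refl; trans; cong; subst)
import Relation.Binary.PropositionalEquality as ≡

open Equivalence using (to; from)

∨-introˡ : ∀ {a} b → a ≡ true → (a ∨ b) ≡ true
∨-introˡ _ refl = refl

∨-introʳ : ∀ a {b} → b ≡ true → (a ∨ b) ≡ true
∨-introʳ true  _ = refl
∨-introʳ false h = h

∨-elim : ∀ a b → (a ∨ b) ≡ true → a ≡ true ⊎ b ≡ true
∨-elim true  _ _ = inj₁ refl
∨-elim false _ h = inj₂ h

∧-intro : ∀ {a b} → a ≡ true → b ≡ true → (a ∧ b) ≡ true
∧-intro refl refl = refl

∧-elim : ∀ a b → (a ∧ b) ≡ true → a ≡ true × b ≡ true
∧-elim a b h = ∧-conicalˡ a b h , ∧-conicalʳ a b h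

not-intro : ∀ {a} → a ≡ false → not a ≡ true
not-intro refl = refl

not-elim : ∀ a → not a ≡ true → a ≡ false
not-elim false _ = refl

≟-true⇒≡ : ∀ {m} {i j : Fin m} → ⌊ i ≟ j ⌋ ≡ true → i ≡ j
≟-true⇒≡ e = toWitness (from T-≡ e)

≢⇒not-≟ : ∀ {m} {i j : Fin m} → i ≢ j → not ⌊ i ≟ j ⌋ ≡ true
≢⇒not-≟ i≢j = to T-≡ (fromWitnessFalse i≢j)

∨-shiftˡ : ∀ a b c d → (b ∨ c ∨ d) ≡ true → ((a ∨ b ∨ c) ∨ d) ≡ true
∨-shiftˡ true  _     _     _ _ = refl
∨-shiftˡ false true  _     _ _ = refl
∨-shiftˡ false false true  _ _ = refl
∨-shiftˡ false false false _ h = h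

∨-shiftʳ : ∀ a b c d → (a ∨ b ∨ c) ≡ true → ((b ∨ c ∨ d) ∨ a) ≡ true
∨-shiftʳ _ true  _     _    _ = refl
∨-shiftʳ _ false true  _    _ = refl
∨-shiftʳ _ false false true _ = refl
∨-shiftʳ a false false false h = trans (≡.sym (∨-identityʳ a)) h

𝟙 : Bool → ℕ
𝟙 b = if b then 1 else 0

𝟙≤1 : ∀ b → 𝟙 b ≤ 1
𝟙≤1 true  = ≤-refl
𝟙≤1 false = z≤n

𝟙-mono : ∀ {a b} → (a ≡ true → b ≡ true) → 𝟙 a ≤ 𝟙 b
𝟙-mono {false}         _ = z≤n
𝟙-mono {true} {true}   _ = ≤-refl
𝟙-mono {true} {false}  f with () ← f refl

𝟙-∨ : ∀ a b → 𝟙 (a ∨ b) ≤ 𝟙 a + 𝟙 b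
𝟙-∨ true  _ = s≤s z≤n
𝟙-∨ false _ = ≤-refl

𝟙-split : ∀ a b → 𝟙 a ≡ 𝟙 (a ∧ b) + 𝟙 (a ∧ not b)
𝟙-split false _     = refl
𝟙-split true  true  = refl
𝟙-split true  false = refl

-- countF m p is definitionally count (allFin m) p.
count : {A : Set} → List A → (A → Bool) → ℕ
count xs p = sum (map (λ x → 𝟙 (p x)) xs)

module _ {A : Set} where

  sum-map-mono : (f g : A → ℕ) → (∀ x → f x ≤ g x) → ∀ xs → sum (map f xs) ≤ sum (map g xs)
  sum-map-mono f g f≤g []       = z≤n
  sum-map-mono f g f≤g (x ∷ xs) = +-mono-≤ (f≤g x) (sum-map-mono f g f≤g xs)

  sum-map-+ : (f g : A → ℕ) → ∀ xs → sum (map (λ x → f x + g x) xs) ≡ sum (map f xs) + sum (map g xs)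
  sum-map-+ f g []       = refl
  sum-map-+ f g (x ∷ xs) =
    trans (cong (f x + g x +_) (sum-map-+ f g xs)) (interchange (f x) (g x) _ _)

  count-mono : ∀ {p q : A → Bool} → (∀ x → p x ≡ true → q x ≡ true) → ∀ xs → count xs p ≤ count xs q
  count-mono p⊆q = sum-map-mono _ _ (λ x → 𝟙-mono (p⊆q x))

  count-∨ : ∀ (p q : A → Bool) xs → count xs (λ x → p x ∨ q x) ≤ count xs p + count xs q
  count-∨ p q xs =
    ≤-trans (sum-map-mono _ _ (λ x → 𝟙-∨ (p x) (q x)) xs) (≤-reflexive (sum-map-+ _ _ xs))

  count-split : ∀ (p q : A → Bool) xs →
    count xs p ≡ count xs (λ x → p x ∧ q x) + count xs (λ x → p x ∧ not (q x))
  count-split p q xs =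
    trans (cong sum (map-cong (λ x → 𝟙-split (p x) (q x)) xs)) (sum-map-+ _ _ xs)

  count-≤-length : ∀ (p : A → Bool) xs → count xs p ≤ length xs
  count-≤-length p []       = z≤n
  count-≤-length p (x ∷ xs) = +-mono-≤ (𝟙≤1 (p x)) (count-≤-length p xs)

  count≡length⇒All : ∀ (p : A → Bool) xs → count xs p ≡ length xs → All (λ x → p x ≡ true) xs
  count≡length⇒All p []       _ = All.[]
  count≡length⇒All p (x ∷ xs) h with p x in px
  ... | true  = px ∷ count≡length⇒All p xs (suc-injective h)
  ... | false = ⊥-elim (1+n≰n (subst (_≤ length xs) h (count-≤-length p xs)))

  count-pos⇒Any : ∀ (p : A → Bool) xs → 0 < count xs p → Any (λ x → p x ≡ true) xs
  count-pos⇒Any p (x ∷ xs) h with p x in px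
  ... | true  = here px
  ... | false = there (count-pos⇒Any p xs h)

countF-≤ : ∀ m (p : Fin m → Bool) → countF m p ≤ m
countF-≤ m p = subst (countF m p ≤_) (length-tabulate id) (count-≤-length p (allFin m))

countF-full : ∀ m (p : Fin m → Bool) → countF m p ≡ m → ∀ i → p i ≡ true
countF-full m p h i =
  All.lookup (count≡length⇒All p (allFin m) (trans h (≡.sym (length-tabulate id)))) (∈-allFin i)

countF-pos : ∀ m (p : Fin m → Bool) → 0 < countF m p → ∃ λ i → p i ≡ true
countF-pos m p h = satisfied (count-pos⇒Any p (allFin m) h)

anyF-intro : ∀ {m} (p : Fin m → Bool) i → p i ≡ true → anyF m p ≡ true
anyF-intro p i h = to T-≡ (any⁺ p (lose (∈-allFin i) (from T-≡ h)))

anyF-elim : ∀ {m} (p : Fin m → Bool) → anyF m p ≡ true → ∃ λ i → p i ≡ true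
anyF-elim {m} p h with i , pi ← satisfied (any⁻ p (allFin m) (from T-≡ h)) = i , to T-≡ pi

other₁ other₂ : Fin 3 → Fin 3
other₁ zero             = suc zero
other₁ (suc zero)       = zero
other₁ (suc (suc zero)) = zero
other₂ zero             = suc (suc zero)
other₂ (suc zero)       = suc (suc zero)
other₂ (suc (suc zero)) = suc zero

differs-from-two : ∀ k c →
  𝟙 (not ⌊ k ≟ c ⌋) + 𝟙 (not ⌊ k ≟ other₁ c ⌋) + 𝟙 (not ⌊ k ≟ other₂ c ⌋) ≡ 2
differs-from-two zero             zero             = refl
differs-from-two zero             (suc zero)       = refl
differs-from-two zero             (suc (suc zero)) = refl
differs-from-two (suc zero)       zero             = refl
differs-from-two (suc zero)       (suc zero)       = refl
differs-from-two (suc zero)       (suc (suc zero)) = refl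
differs-from-two (suc (suc zero)) zero             = refl
differs-from-two (suc (suc zero)) (suc zero)       = refl
differs-from-two (suc (suc zero)) (suc (suc zero)) = refl

both-true : ∀ a b → 2 ≤ 𝟙 a + (𝟙 b + 0) → a ≡ true × b ≡ true
both-true true  true  _ = refl , refl
both-true true  false (s≤s ())
both-true false true  (s≤s ())
both-true false false ()

missing-colour : ∀ (P : Fin 3 → Bool) c → P c ≢ true → 2 ≤ countF 3 P →
  P (other₁ c) ≡ true × P (other₂ c) ≡ true
missing-colour P zero ¬Pc h with P zero
... | true  = ⊥-elim (¬Pc refl)
... | false = both-true _ _ h
missing-colour P (suc zero) ¬Pc h with P (suc zero)
... | true  = ⊥-elim (¬Pc refl)
... | false = both-true _ _ h
missing-colour P (suc (suc zero)) ¬Pc h with P (suc (suc zero))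
... | true  = ⊥-elim (¬Pc refl)
... | false = both-true _ _ h

-- If P misses a colour, that colour lies in Q; otherwise any colour of Q will do.
colour-split : ∀ (P Q : Fin 3 → Bool) → 2 ≤ countF 3 P → 1 ≤ countF 3 Q →
  (∀ k → (P k ∨ Q k) ≡ true) → ∃ λ c → Q c ≡ true × P (other₁ c) ≡ true × P (other₂ c) ≡ true
colour-split P Q hP hQ cover with all? (λ k → P k ≟ᵇ true)
... | yes allP = let (c , Qc) = countF-pos 3 Q hQ in c , Qc , allP _ , allP _
... | no ¬allP with ¬∀⟶∃¬ 3 (λ k → P k ≡ true) (λ k → P k ≟ᵇ true) ¬allP
...   | c , ¬Pc with ∨-elim (P c) (Q c) (cover c)
...     | inj₁ Pc = ⊥-elim (¬Pc Pc)
...     | inj₂ Qc = c , Qc , missing-colour P c ¬Pc hP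

offColour : {A : Set} → (A → Fin 3) → (A → Bool) → Fin 3 → A → Bool
offColour col S a u = S u ∧ not ⌊ col u ≟ a ⌋

module _ {A : Set} (col : A → Fin 3) where

  offColour-sum : ∀ (S : A → Bool) c xs →
    count xs (offColour col S c) + count xs (offColour col S (other₁ c))
      + count xs (offColour col S (other₂ c)) ≡ 2 * count xs S
  offColour-sum S c xs = begin
    N c + N (other₁ c) + N (other₂ c)
      ≡⟨ cong (_+ N (other₂ c)) (sum-map-+ _ _ xs) ⟨
    sum (map (λ u → 𝟙 (off c u) + 𝟙 (off (other₁ c) u)) xs) + N (other₂ c)
      ≡⟨ sum-map-+ _ _ xs ⟨
    sum (map (λ u → 𝟙 (off c u) + 𝟙 (off (other₁ c) u) + 𝟙 (off (other₂ c) u)) xs)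
      ≡⟨ cong sum (map-cong (λ u → pointwise (S u) (col u)) xs) ⟩
    sum (map (λ u → 𝟙 (S u) + 𝟙 (S u)) xs)
      ≡⟨ sum-map-+ _ _ xs ⟩
    count xs S + count xs S
      ≡⟨ cong (count xs S +_) (+-identityʳ _) ⟨
    2 * count xs S ∎
    where
    open ≡.≡-Reasoning
    off : Fin 3 → A → Bool
    off = offColour col S
    N : Fin 3 → ℕ
    N a = count xs (off a)
    pointwise : ∀ s k →
      𝟙 (s ∧ not ⌊ k ≟ c ⌋) + 𝟙 (s ∧ not ⌊ k ≟ other₁ c ⌋) + 𝟙 (s ∧ not ⌊ k ≟ other₂ c ⌋)
        ≡ 𝟙 s + 𝟙 s
    pointwise false k = refl
    pointwise true  k = differs-from-two k c

  offColour-shift : ∀ (S S′ R : A → Bool) c → (∀ u → S′ u ≡ true → (S u ∨ R u) ≡ true) → ∀ xs →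
    count xs (offColour col S′ c) ≤ count xs (offColour col S c) + count xs R
  offColour-shift S S′ R c S′⊆S∪R xs =
    ≤-trans (count-mono pointwise xs) (count-∨ (offColour col S c) R xs)
    where
    pointwise : ∀ u → offColour col S′ c u ≡ true → (offColour col S c u ∨ R u) ≡ true
    pointwise u h with s′ , ≢c ← ∧-elim (S′ u) _ h with ∨-elim (S u) (R u) (S′⊆S∪R u s′)
    ... | inj₁ s = ∨-introˡ _ (∧-intro s ≢c)
    ... | inj₂ r = ∨-introʳ _ r

module Layers {n : ℕ} (G : Graph n) (x : Fin n) where

  W L : ℕ → Fin n → Bool
  W = within G x
  L = layer G x

  ℓ : ℕ → ℕ
  ℓ = layerSize G x

  within-suc : ∀ k {u} → W k u ≡ true → W (suc k) u ≡ true
  within-suc k h = ∨-introˡ _ h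

  within-step : ∀ k {w u} → W k w ≡ true → Adj G w u ≡ true → W (suc k) u ≡ true
  within-step k {w} {u} hw adj =
    ∨-introʳ (W k u) (anyF-intro (λ w′ → W k w′ ∧ Adj G w′ u) w (∧-intro hw adj))

  Band : ℕ → Fin n → Bool
  Band j u = L j u ∨ L (suc j) u ∨ L (suc (suc j)) u

  band-count : ∀ j → countF n (Band j) ≤ ℓ j + (ℓ (suc j) + ℓ (suc (suc j)))
  band-count j =
    ≤-trans (count-∨ (L j) _ (allFin n))
            (+-mono-≤ (≤-refl {ℓ j}) (count-∨ (L (suc j)) (L (suc (suc j))) (allFin n)))

  adjacent-within⇒layer : ∀ j {v u} → L (suc j) v ≡ true → Adj G v u ≡ true → W j u ≡ true →
    L j u ≡ true
  adjacent-within⇒layer zero    _ _ u∈W = u∈W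
  adjacent-within⇒layer (suc k) {v} {u} v∈L adj u∈W with W k u ≟ᵇ true
  ... | no u∉Wk = ∧-intro u∈W (not-intro (¬-not u∉Wk))
  ... | yes u∈Wk with () ← trans (≡.sym (within-step k u∈Wk (trans (Graph.sym G u v) adj)))
                                 (not-elim _ (proj₂ (∧-elim _ _ v∈L)))

  adjacent-layers : ∀ j {v u} → L (suc j) v ≡ true → Adj G v u ≡ true → Band j u ≡ true
  adjacent-layers j {v} {u} v∈L adj with W (suc j) u ≟ᵇ true | W j u ≟ᵇ true
  ... | no u∉W₊ | _ = ∨-introʳ (L j u) (∨-introʳ (L (suc j) u) (∧-intro
                        (within-step (suc j) (proj₁ (∧-elim _ _ v∈L)) adj) (not-intro (¬-not u∉W₊))))
  ... | yes u∈W₊ | no u∉W = ∨-introʳ (L j u) (∨-introˡ (L (suc (suc j)) u) (∧-intro u∈W₊ (not-intro (¬-not u∉W))))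
  ... | yes _    | yes u∈W = ∨-introˡ _ (adjacent-within⇒layer j v∈L adj u∈W)

  within-grows : ∀ k → countF n (W k) + ℓ (suc k) ≤ countF n (W (suc k))
  within-grows k = begin
    countF n (W k) + ℓ (suc k)
      ≤⟨ +-monoˡ-≤ _ (count-mono (λ u h → ∧-intro (within-suc k h) h) (allFin n)) ⟩
    countF n (λ u → W (suc k) u ∧ W k u) + countF n (λ u → W (suc k) u ∧ not (W k u))
      ≡⟨ count-split (W (suc k)) (W k) (allFin n) ⟨
    countF n (W (suc k)) ∎
    where open ≤-Reasoning

  layersAbove : ℕ → ℕ → ℕ
  layersAbove k zero    = 0
  layersAbove k (suc t) = ℓ (suc k) + layersAbove (suc k) t

  within-grows-by : ∀ t k → countF n (W k) + layersAbove k t ≤ countF n (W (t + k))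
  within-grows-by zero    k = ≤-reflexive (+-identityʳ _)
  within-grows-by (suc t) k = begin
    countF n (W k) + (ℓ (suc k) + layersAbove (suc k) t)
      ≡⟨ +-assoc (countF n (W k)) _ _ ⟨
    countF n (W k) + ℓ (suc k) + layersAbove (suc k) t
      ≤⟨ +-monoˡ-≤ _ (within-grows k) ⟩
    countF n (W (suc k)) + layersAbove (suc k) t
      ≤⟨ within-grows-by t (suc k) ⟩
    countF n (W (t + suc k))
      ≡⟨ cong (countF n ∘ W) (+-suc t k) ⟩
    countF n (W (suc t + k)) ∎
    where open ≤-Reasoning

module DiameterBound {n : ℕ} (G : Graph n) (x : Fin n) (col : Fin n → Fin 3)
                     (proper : ProperColoring G col) (δ : ℕ) (minDeg : MinDegreeAtLeast G δ) where

  open Layers G x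

  present-in : (Fin n → Bool) → Fin 3 → Bool
  present-in S a = anyF n (λ v → S v ∧ ⌊ col v ≟ a ⌋)

  present : ℕ → Fin 3 → Bool
  present j = present-in (L j)

  avoiding : ℕ → Fin 3 → ℕ
  avoiding j a = countF n (offColour col (Band j) a)

  degree-bound : ∀ j a → present (suc j) a ≡ true → δ ≤ avoiding j a
  degree-bound j a h with v , hv ← anyF-elim _ h with v∈L , colv≡a ← ∧-elim _ _ hv =
    subst (λ b → δ ≤ avoiding j b) (≟-true⇒≡ colv≡a)
    (≤-trans (minDeg v) (count-mono neighbour-avoids (allFin n)))
    where
    neighbour-avoids : ∀ u → Adj G v u ≡ true → offColour col (Band j) (col v) u ≡ true
    neighbour-avoids u adj =
      ∧-intro (adjacent-layers j v∈L adj) (≢⇒not-≟ (λ e → proper v u adj (≡.sym e)))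

  band-bound : ∀ j j′ t → (∀ u → Band j′ u ≡ true → (Band j u ∨ L t u) ≡ true) →
    2 ≤ c G col x (suc j) → 1 ≤ c G col x (suc j′) →
    (∀ a → (present (suc j) a ∨ present (suc j′) a) ≡ true) →
    3 * δ ≤ 2 * countF n (Band j) + ℓ t
  band-bound j j′ t j′⊆j∪t two one cover
    with c , hc , h₁ , h₂ ← colour-split (present (suc j)) (present (suc j′)) two one cover = begin
    3 * δ
      ≡⟨ three-times δ ⟩
    δ + δ + δ
      ≤⟨ +-mono-≤ (+-mono-≤ (degree-bound j′ c hc) (degree-bound j _ h₁)) (degree-bound j _ h₂) ⟩
    avoiding j′ c + avoiding j (other₁ c) + avoiding j (other₂ c)
      ≤⟨ +-monoˡ-≤ _ (+-monoˡ-≤ _ (offColour-shift col _ _ (L t) c j′⊆j∪t (allFin n))) ⟩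
    (avoiding j c + ℓ t) + avoiding j (other₁ c) + avoiding j (other₂ c)
      ≡⟨ move-last (avoiding j c) (ℓ t) _ _ ⟩
    avoiding j c + avoiding j (other₁ c) + avoiding j (other₂ c) + ℓ t
      ≡⟨ cong (_+ ℓ t) (offColour-sum col (Band j) c (allFin n)) ⟩
    2 * countF n (Band j) + ℓ t ∎
    where
    open ≤-Reasoning
    three-times : ∀ d → 3 * d ≡ d + d + d
    three-times = solve-∀
    move-last : ∀ a t b c → a + t + b + c ≡ a + b + c + t
    move-last = solve-∀

  union-colours : ∀ i → numColors col (λ v → L i v ∨ L (suc i) v) ≡ 3 →
    ∀ a → (present i a ∨ present (suc i) a) ≡ true
  union-colours i uses-three a
    with v , hv ← anyF-elim _ (countF-full 3 (present-in (λ v → L i v ∨ L (suc i) v)) uses-three a)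
    with v∈L , colv ← ∧-elim _ _ hv with ∨-elim (L i v) _ v∈L
  ... | inj₁ v∈Li  = ∨-introˡ _ (anyF-intro _ v (∧-intro v∈Li colv))
  ... | inj₂ v∈Li₊ = ∨-introʳ _ (anyF-intro _ v (∧-intro v∈Li₊ colv))

  module _ (D : ℕ) (canonical : Canonical G col x D)
           (interior : ∀ i → 0 < i → i < D → 2 ≤ c G col x i) where

    interior-pair : ∀ i → 0 < i → suc i < D →
      2 ≤ c G col x i × 2 ≤ c G col x (suc i) × (∀ a → (present i a ∨ present (suc i) a) ≡ true)
    interior-pair i 0<i i+1<D = cᵢ , cᵢ₊₁ , union-colours i uses-three
      where
      i<D : i < D
      i<D = ≤-trans (n≤1+n (suc i)) i+1<D
      cᵢ : 2 ≤ c G col x i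
      cᵢ = interior i 0<i i<D
      cᵢ₊₁ : 2 ≤ c G col x (suc i)
      cᵢ₊₁ = interior (suc i) (s≤s z≤n) i+1<D
      uses-three : numColors col (λ v → L i v ∨ L (suc i) v) ≡ 3
      uses-three = trans (proj₁ (proj₂ (canonical i i<D)))
                         (m≤n⇒m⊓n≡m (≤-trans (n≤1+n 3) (+-mono-≤ cᵢ cᵢ₊₁)))

    seven-layers : ∀ k → 7 + k ≤ D → 3 * δ ≤ layersAbove k 7
    seven-layers k 7+k≤D = *-cancelˡ-≤ 2 (begin
      2 * (3 * δ)                       ≡⟨ cong (3 * δ +_) (+-identityʳ _) ⟩
      3 * δ + 3 * δ                     ≤⟨ +-mono-≤ forward backward ⟩
      (2 * (ℓ (1 + k) + (ℓ (2 + k) + ℓ (3 + k))) + ℓ (4 + k))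
        + (2 * (ℓ (5 + k) + (ℓ (6 + k) + ℓ (7 + k))) + ℓ (4 + k))
                                        ≡⟨ regroup (ℓ (1 + k)) (ℓ (2 + k)) (ℓ (3 + k)) (ℓ (4 + k))
                                                   (ℓ (5 + k)) (ℓ (6 + k)) (ℓ (7 + k)) ⟩
      2 * layersAbove k 7 ∎)
      where
      open ≤-Reasoning
      regroup : ∀ a b c d e f g → (2 * (a + (b + c)) + d) + (2 * (e + (f + g)) + d)
                                  ≡ 2 * (a + (b + (c + (d + (e + (f + (g + 0)))))))
      regroup = solve-∀
      in-range : ∀ i j → i + j ≡ 7 → i + k ≤ D
      in-range i j e = ≤-trans (+-monoˡ-≤ k (subst (i ≤_) e (m≤m+n i j))) 7+k≤D
      forward : 3 * δ ≤ 2 * (ℓ (1 + k) + (ℓ (2 + k) + ℓ (3 + k))) + ℓ (4 + k)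
      forward =
        let (c₂ , c₃ , cover) = interior-pair (2 + k) (s≤s z≤n) (in-range 4 3 refl) in
        ≤-trans (band-bound (1 + k) (2 + k) (4 + k)
                  (λ u → ∨-shiftˡ (L (1 + k) u) (L (2 + k) u) (L (3 + k) u) (L (4 + k) u))
                  c₂ (≤-trans (n≤1+n 1) c₃) cover)
                (+-monoˡ-≤ _ (*-monoʳ-≤ 2 (band-count (1 + k))))
      backward : 3 * δ ≤ 2 * (ℓ (5 + k) + (ℓ (6 + k) + ℓ (7 + k))) + ℓ (4 + k)
      backward =
        let (c₅ , c₆ , cover) = interior-pair (5 + k) (s≤s z≤n) 7+k≤D in
        ≤-trans (band-bound (5 + k) (4 + k) (4 + k)
                  (λ u → ∨-shiftʳ (L (4 + k) u) (L (5 + k) u) (L (6 + k) u) (L (7 + k) u))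
                  c₆ (≤-trans (n≤1+n 1) c₅)
                  (λ a → trans (∨-comm (present (6 + k) a) (present (5 + k) a)) (cover a)))
                (+-monoˡ-≤ _ (*-monoʳ-≤ 2 (band-count (5 + k))))

    runs : ∀ m → m * 7 ≤ D → m * (3 * δ) ≤ countF n (W (m * 7))
    runs zero    _  = z≤n
    runs (suc m) le = begin
      3 * δ + m * (3 * δ)                     ≤⟨ +-mono-≤ (seven-layers (m * 7) le)
                                                             (runs m (≤-trans (m≤n+m _ 7) le)) ⟩
      layersAbove (m * 7) 7 + countF n (W (m * 7)) ≡⟨ +-comm _ (countF n (W (m * 7))) ⟩
      countF n (W (m * 7)) + layersAbove (m * 7) 7 ≤⟨ within-grows-by 7 (m * 7) ⟩
      countF n (W (7 + m * 7)) ∎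
      where open ≤-Reasoning

    diameter-bound : 3 * δ * D ≤ 7 * n + 3 * δ * 6
    diameter-bound = begin
      3 * δ * D                         ≤⟨ *-monoʳ-≤ (3 * δ) D≤ ⟩
      3 * δ * (6 + D / 7 * 7)           ≡⟨ expand δ (D / 7) ⟩
      7 * (D / 7 * (3 * δ)) + 3 * δ * 6 ≤⟨ +-monoˡ-≤ _ (*-monoʳ-≤ 7 runs≤n) ⟩
      7 * n + 3 * δ * 6 ∎
      where
      open ≤-Reasoning
      expand : ∀ d m → 3 * d * (6 + m * 7) ≡ 7 * (m * (3 * d)) + 3 * d * 6
      expand = solve-∀
      D≤ : D ≤ 6 + D / 7 * 7
      D≤ = ≤-trans (≤-reflexive (m≡m%n+[m/n]*n D 7)) (+-monoˡ-≤ _ (≤-pred (m%n<n D 7)))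
      runs≤n : D / 7 * (3 * δ) ≤ n
      runs≤n = ≤-trans (runs (D / 7) (m/n*n≤m D 7)) (countF-≤ n _)

theorem7p1 : ∃ λ (C : ℕ) → ∀ {n : ℕ} (G : Graph n) (D δ : ℕ) →
    1 ≤ δ → Connected G → Diameter G D → MinDegreeAtLeast G δ →
    (col : Fin n → Fin 3) → ProperColoring G col →
    (x : Fin n) → Eccentricity G x D → Canonical G col x D →
    (∀ i → 0 < i → i < D → 2 ≤ c G col x i) →
    3 * δ * D ≤ 7 * n + 3 * δ * C
theorem7p1 = 6 , λ G D δ _ _ _ minDeg col proper x _ canonical interior →
  DiameterBound.diameter-bound G x col proper δ minDeg D canonical interior
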